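{- Let $n\ge 3$ and let $p\neq q$ be integers such that there is a permutation $\pi$ of $\{1,2,\ldots,n\}$ whose set of discrete derivative values $\{\pi_{i+1}-\pi_i: 1\le i\le n-1\}$ equals $\{p,q\}$. Then $p$ and $q$ have opposite signs, and $p$ and $q$ are relatively prime.
   Context: A pair $(p,q)$ of distinct integers is called a $D$-pair if for some $n\ge 1$ there is a permutation $\pi$ of $\{1,\ldots,n\}$ with $\{\pi_{i+1}-\pi_i : i\le n-1\}=\{p,q\}$. -}

module Defs where

open import Data.Nat as ℕ using (ℕ; suc)
open import Data.Integer as ℤ using (ℤ; +_; _-_)
open import Data.Fin using (Fin; toℕ)
open import Data.Fin.Permutation using (Permutation′; _⟨$⟩ʳ_)
open import Data.Sum using (_⊎_)
open import Data.Product using (_×_; ∃₂)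
open import Relation.Binary.PropositionalEquality using (_≡_)

-- Value of the permutation at a position, as an integer.
-- Positions/values 1..n are encoded by Fin n (i ↦ toℕ i + 1); the shift
-- by 1 does not affect differences.
val : ∀ {n} → Permutation′ n → Fin n → ℤ
val π i = + toℕ (π ⟨$⟩ʳ i)

IsDerivValue : ∀ {n} → Permutation′ n → ℤ → Set
IsDerivValue {n} π d =
  ∃₂ λ (i j : Fin n) → (toℕ j ≡ suc (toℕ i)) × (val π j - val π i ≡ d)

DerivSetIs : ∀ {n} → Permutation′ n → ℤ → ℤ → Set
DerivSetIs π p q =
  (∀ d → IsDerivValue π d → (d ≡ p ⊎ d ≡ q))
  × IsDerivValue π p × IsDerivValue π q

-- If all steps of a walk f through the values 0, …, n − 1 are positive, then
-- f(k) − k is non-decreasing, at least 0 at the start and at most 0 at the end,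
-- so f(k) = k and every step is 1; negative steps reduce to this by reflecting
-- the values v ↦ n − 1 − v. Hence no two distinct derivative values share a sign,
-- and 0 is none by injectivity. Every difference of values is a sum of steps,
-- so a common divisor of p and q divides the difference 1 of the values 1 and 0.
module Submission where

open import Defs
open import Data.Nat as ℕ using (ℕ; _≤_)
open import Data.Integer as ℤ using (ℤ; _<_; +_; ∣_∣)
open import Data.Nat.Coprimality using (Coprime)
open import Data.Fin.Permutation using (Permutation′)
open import Data.Sum using (_⊎_)
open import Data.Product using (_×_; Σ)
open import Relation.Binary.PropositionalEquality using (_≢_)

open import Data.Nat using (zero; suc; s≤s; z≤n)
import Data.Nat.Properties as ℕ
open import Data.Nat.Divisibility using (∣1⇒≡1)
open import Data.Integer using (0ℤ; 1ℤ; +0; +[1+_]; -[1+_]; -_; _-_; _+_; -<+; +<+; +≤+)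
import Data.Integer.Properties as ℤ
open import Data.Integer.Divisibility.Signed using (_∣_; divides; ∣m∣n⇒∣m+n; ∣m∣n⇒∣m-n; ∣ᵤ⇒∣; ∣⇒∣ᵤ)
open import Data.Integer.Tactic.RingSolver using (solve-∀)
open import Data.Fin using (Fin; toℕ; fromℕ)
import Data.Fin as Fin
import Data.Fin.Properties as Fin
open import Data.Fin.Permutation using (_⟨$⟩ʳ_; _⟨$⟩ˡ_; inverseʳ)
open import Function.Bundles using (Injection)
open import Function.Properties.Inverse using (↔⇒↣)
open import Data.Sum using (inj₁; inj₂; [_,_])
open import Data.Product using (_,_)
open import Data.Empty using (⊥-elim)
open import Relation.Binary.Core using (Rel)
open import Relation.Binary.Definitions using (Reflexive; Transitive)
open import Relation.Binary.PropositionalEquality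
  using (_≡_; refl; sym; trans; cong; cong₂; subst; module ≡-Reasoning)

Adjacent : ∀ {n} → Fin n → Fin n → Set
Adjacent i j = toℕ j ≡ suc (toℕ i)

module _ {a ℓ} {A : Set a} (_∼_ : Rel A ℓ) (∼-refl : Reflexive _∼_) (∼-trans : Transitive _∼_)
         {n : ℕ} (f : Fin n → A) (adjacent⇒∼ : ∀ {i j} → Adjacent i j → f i ∼ f j) where

  related-at-distance : ∀ d {i k} → d ℕ.+ toℕ i ≡ toℕ k → f i ∼ f k
  related-at-distance zero    {i} i≡k = subst (λ x → f i ∼ f x) (Fin.toℕ-injective i≡k) ∼-refl
  related-at-distance (suc d) {k = Fin.suc k} eq =
    ∼-trans (related-at-distance d (trans (ℕ.suc-injective eq) (sym (Fin.toℕ-inject₁ k))))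
            (adjacent⇒∼ (cong suc (sym (Fin.toℕ-inject₁ k))))

  ≤⇒related : ∀ {i k} → i Fin.≤ k → f i ∼ f k
  ≤⇒related {i} {k} i≤k =
    related-at-distance (toℕ k ℕ.∸ toℕ i) (trans (ℕ.+-comm _ (toℕ i)) (ℕ.m+[n∸m]≡n i≤k))

module _ {m : ℕ} (f : Fin (suc m) → ℤ) (0≤f : ∀ k → + 0 ℤ.≤ f k) (f≤m : ∀ k → f k ℤ.≤ + m) where

  increasing⇒≡toℕ : (∀ {i j} → Adjacent i j → + 0 < f j - f i) → ∀ k → f k ≡ + toℕ k
  increasing⇒≡toℕ increasing k = ℤ.i-j≡0⇒i≡j (f k) (+ toℕ k)
    (ℤ.≤-antisym (ℤ.≤-trans (excess-monotone (Fin.≤fromℕ k)) excess-last≤0)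
                 (ℤ.≤-trans 0≤excess-first (excess-monotone z≤n)))
    where
    excess : Fin (suc m) → ℤ
    excess k = f k - + toℕ k

    adjacent⇒excess≤ : ∀ {i j} → Adjacent i j → excess i ℤ.≤ excess j
    adjacent⇒excess≤ {i} {j} j≡1+i =
      ℤ.0≤i-j⇒j≤i (subst (+ 0 ℤ.≤_) (sym shift) (ℤ.i≤j⇒0≤j-i (ℤ.i<j⇒suc[i]≤j (increasing j≡1+i))))
      where
      shift : excess j - excess i ≡ (f j - f i) - 1ℤ
      shift rewrite j≡1+i = unit-shift (f j) (f i) (+ toℕ i)
        where
        unit-shift : ∀ a b t → (a - (1ℤ + t)) - (b - t) ≡ (a - b) - 1ℤ
        unit-shift = solve-∀

    excess-monotone : ∀ {i k} → i Fin.≤ k → excess i ℤ.≤ excess k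
    excess-monotone = ≤⇒related ℤ._≤_ ℤ.≤-refl ℤ.≤-trans excess adjacent⇒excess≤

    0≤excess-first : + 0 ℤ.≤ excess Fin.zero
    0≤excess-first = subst (+ 0 ℤ.≤_) (sym (ℤ.+-identityʳ (f Fin.zero))) (0≤f Fin.zero)

    excess-last≤0 : excess (fromℕ m) ℤ.≤ + 0
    excess-last≤0 =
      ℤ.i≤j⇒i-j≤0 (subst (λ t → f (fromℕ m) ℤ.≤ + t) (sym (Fin.toℕ-fromℕ m)) (f≤m (fromℕ m)))

  increasing⇒unit-steps : (∀ {i j} → Adjacent i j → + 0 < f j - f i) →
                          ∀ {i j} → Adjacent i j → f j - f i ≡ 1ℤ
  increasing⇒unit-steps increasing {i} {j} j≡1+i = begin
    f j - f i                 ≡⟨ cong₂ _-_ (increasing⇒≡toℕ increasing j) (increasing⇒≡toℕ increasing i) ⟩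
    + toℕ j - + toℕ i         ≡⟨ cong (λ t → + t - + toℕ i) j≡1+i ⟩
    (1ℤ + + toℕ i) - + toℕ i  ≡⟨ successor-minus (+ toℕ i) ⟩
    1ℤ                        ∎
    where
    open ≡-Reasoning
    successor-minus : ∀ t → (1ℤ + t) - t ≡ 1ℤ
    successor-minus = solve-∀

decreasing⇒unit-steps : ∀ {m} (f : Fin (suc m) → ℤ) → (∀ k → + 0 ℤ.≤ f k) → (∀ k → f k ℤ.≤ + m) →
                        (∀ {i j} → Adjacent i j → f j - f i < + 0) →
                        ∀ {i j} → Adjacent i j → f j - f i ≡ - 1ℤ
decreasing⇒unit-steps {m} f 0≤f f≤m decreasing {i} {j} j≡1+i = begin
  f j - f i          ≡⟨ sym (ℤ.neg-involutive (f j - f i)) ⟩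
  - - (f j - f i)    ≡⟨ cong -_ (sym (reflected-step i j)) ⟩
  - (g j - g i)      ≡⟨ cong -_ (increasing⇒unit-steps g 0≤g g≤m g-increasing j≡1+i) ⟩
  - 1ℤ               ∎
  where
  open ≡-Reasoning
  g : Fin (suc m) → ℤ
  g k = + m - f k

  0≤g : ∀ k → + 0 ℤ.≤ g k
  0≤g k = ℤ.i≤j⇒0≤j-i (f≤m k)

  g≤m : ∀ k → g k ℤ.≤ + m
  g≤m k = subst (g k ℤ.≤_) (ℤ.+-identityʳ (+ m)) (ℤ.+-monoʳ-≤ (+ m) (ℤ.neg-mono-≤ (0≤f k)))

  reflected-step : ∀ i j → g j - g i ≡ - (f j - f i)
  reflected-step i j = reflect (+ m) (f i) (f j)
    where
    reflect : ∀ c a b → (c - b) - (c - a) ≡ - (b - a)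
    reflect = solve-∀

  g-increasing : ∀ {i j} → Adjacent i j → + 0 < g j - g i
  g-increasing {i} {j} adj = subst (+ 0 <_) (sym (reflected-step i j)) (ℤ.neg-mono-< (decreasing adj))

steps-divisible⇒differences-divisible : ∀ {n} (f : Fin (suc n) → ℤ) {d} →
  (∀ {i j} → Adjacent i j → d ∣ f j - f i) → ∀ i j → d ∣ f j - f i
steps-divisible⇒differences-divisible f {d} step∣ i j =
  subst (d ∣_) (cancel-base (f i) (f j) (f Fin.zero)) (∣m∣n⇒∣m-n (from-first j) (from-first i))
  where
  _≡_mod-d : ℤ → ℤ → Set
  a ≡ b mod-d = d ∣ b - a

  mod-d-refl : Reflexive _≡_mod-d
  mod-d-refl {a} = subst (d ∣_) (sym (ℤ.+-inverseʳ a)) (divides 0ℤ (sym (ℤ.*-zeroˡ d)))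

  mod-d-trans : Transitive _≡_mod-d
  mod-d-trans {a} {b} {c} a≡b b≡c = subst (d ∣_) (ℤ.+-minus-telescope c b a) (∣m∣n⇒∣m+n b≡c a≡b)

  from-first : ∀ k → d ∣ f k - f Fin.zero
  -- η-expanded because the unfolding of _≡_mod-d hides its implicit arguments from unification.
  from-first k = ≤⇒related _≡_mod-d (λ {a} → mod-d-refl {a}) (λ {a} {b} {c} → mod-d-trans {a} {b} {c})
                           f step∣ {Fin.zero} {k} z≤n

  cancel-base : ∀ a b c → (b - c) - (a - c) ≡ b - a
  cancel-base = solve-∀

module _ {m : ℕ} (π : Permutation′ (suc m)) where

  0≤val : ∀ k → + 0 ℤ.≤ val π k
  0≤val k = +≤+ z≤n

  val≤m : ∀ k → val π k ℤ.≤ + m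
  val≤m k = +≤+ (Fin.toℕ≤pred[n] (π ⟨$⟩ʳ k))

  val-injective : ∀ {i j} → val π i ≡ val π j → i ≡ j
  val-injective eq = Injection.injective (↔⇒↣ π) (Fin.toℕ-injective (ℤ.+-injective eq))

  derivValue≢0 : ∀ {d} → IsDerivValue π d → d ≢ 0ℤ
  derivValue≢0 (_ , _ , j≡1+i , refl) step≡0 =
    ℕ.1+n≢n (trans (sym j≡1+i) (cong toℕ (val-injective (ℤ.i-j≡0⇒i≡j _ _ step≡0))))

  positive-derivValues⇒≡1 : (∀ {d} → IsDerivValue π d → + 0 < d) → ∀ {d} → IsDerivValue π d → d ≡ 1ℤ
  positive-derivValues⇒≡1 positive (_ , _ , j≡1+i , refl) =
    increasing⇒unit-steps (val π) 0≤val val≤m (λ adj → positive (_ , _ , adj , refl)) j≡1+i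

  negative-derivValues⇒≡-1 : (∀ {d} → IsDerivValue π d → d < + 0) → ∀ {d} → IsDerivValue π d → d ≡ - 1ℤ
  negative-derivValues⇒≡-1 negative (_ , _ , j≡1+i , refl) =
    decreasing⇒unit-steps (val π) 0≤val val≤m (λ adj → negative (_ , _ , adj , refl)) j≡1+i

  derivValues-satisfy : ∀ {p q} (P : ℤ → Set) → (∀ d → IsDerivValue π d → d ≡ p ⊎ d ≡ q) →
                        P p → P q → ∀ {d} → IsDerivValue π d → P d
  derivValues-satisfy P only Pp Pq {d} d∈ =
    [ (λ d≡p → subst P (sym d≡p) Pp) , (λ d≡q → subst P (sym d≡q) Pq) ] (only d d∈)

  derivSet-opposite-signs : ∀ p q → p ≢ q → DerivSetIs π p q →
                            ((p < + 0) × (+ 0 < q)) ⊎ ((q < + 0) × (+ 0 < p))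
  derivSet-opposite-signs +0       q        _   (_ , p∈ , _)    = ⊥-elim (derivValue≢0 p∈ refl)
  derivSet-opposite-signs p        +0       _   (_ , _ , q∈)    = ⊥-elim (derivValue≢0 q∈ refl)
  derivSet-opposite-signs -[1+ _ ] +[1+ _ ] _   _               = inj₁ (-<+ , +<+ (s≤s z≤n))
  derivSet-opposite-signs +[1+ _ ] -[1+ _ ] _   _               = inj₂ (-<+ , +<+ (s≤s z≤n))
  derivSet-opposite-signs +[1+ _ ] +[1+ _ ] p≢q (only , p∈ , q∈) =
    ⊥-elim (p≢q (trans (≡1 p∈) (sym (≡1 q∈))))
    where
    ≡1 : ∀ {d} → IsDerivValue π d → d ≡ 1ℤ
    ≡1 = positive-derivValues⇒≡1 (derivValues-satisfy (+ 0 <_) only (+<+ (s≤s z≤n)) (+<+ (s≤s z≤n)))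
  derivSet-opposite-signs -[1+ _ ] -[1+ _ ] p≢q (only , p∈ , q∈) =
    ⊥-elim (p≢q (trans (≡-1 p∈) (sym (≡-1 q∈))))
    where
    ≡-1 : ∀ {d} → IsDerivValue π d → d ≡ - 1ℤ
    ≡-1 = negative-derivValues⇒≡-1 (derivValues-satisfy (_< + 0) only -<+ -<+)

derivSet-coprime : ∀ {m} (π : Permutation′ (suc (suc m))) {p q} → DerivSetIs π p q → Coprime ∣ p ∣ ∣ q ∣
derivSet-coprime π (only , _ , _) {d} (d∣p , d∣q) =
  ∣1⇒≡1 (∣⇒∣ᵤ (subst (+ d ∣_) values-1-and-0
                  (steps-divisible⇒differences-divisible (val π) step∣ at-0 at-1)))
  where
  at-0 at-1 : Fin _
  at-0 = π ⟨$⟩ˡ Fin.zero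
  at-1 = π ⟨$⟩ˡ Fin.suc Fin.zero

  step∣ : ∀ {i j} → Adjacent i j → + d ∣ val π j - val π i
  step∣ adj = derivValues-satisfy π (+ d ∣_) only (∣ᵤ⇒∣ d∣p) (∣ᵤ⇒∣ d∣q) (_ , _ , adj , refl)

  values-1-and-0 : val π at-1 - val π at-0 ≡ 1ℤ
  values-1-and-0 = cong₂ (λ a b → + toℕ a - + toℕ b) (inverseʳ π) (inverseʳ π)

lemma2p4 : (n : ℕ) → 3 ≤ n → (p q : ℤ) → p ≢ q →
           Σ (Permutation′ n) (λ π → DerivSetIs π p q) →
           (((p < + 0) × (+ 0 < q)) ⊎ ((q < + 0) × (+ 0 < p)))
           × Coprime ∣ p ∣ ∣ q ∣
lemma2p4 (suc (suc _)) (s≤s _) p q p≢q (π , derivSet) =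
  derivSet-opposite-signs π p q p≢q derivSet , derivSet-coprime π derivSet
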